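{- For every integer $k\ge2$, $$\frac{B_k}{k}\left(1-\frac{1}{2^k}\right)=\frac{1}{4^k}\sum_{r=1}^{k-1}\binom{k-2}{r-1}E_{k-r-1}E_{r-1}.$$
   Context: $B_k$ are the Bernoulli numbers, $\frac{te^t}{e^t-1}=\sum_{n\ge0}B_nt^n/n!$, and $E_k$ are the Euler numbers, $\frac{2}{e^t+e^{ -t}}=\sum_{k\ge0}E_kt^k/k!$. -}

module Defs where

open import Data.Nat as ℕ using (ℕ; zero; suc; _∸_; _≤_; z≤n; s≤s; NonZero)
open import Data.Nat.Properties using (≤-trans)
open import Data.Nat.Combinatorics using (_C_)
open import Data.Integer using (+_)
open import Data.Rational using (ℚ; 0ℚ; 1ℚ; _+_; _*_; _-_; -_; _/_)
open import Data.Fin using (Fin; toℕ)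
open import Data.Vec using (Vec; []; _∷_; _∷ʳ_; lookup; allFin; map; foldr; last)
open import Data.List as List using (List)
open import Data.Bool using (if_then_else_)

ℕ→ℚ : ℕ → ℚ
ℕ→ℚ n = (+ n) / 1

ΣFin : ∀ {n} → (Fin n → ℚ) → ℚ
ΣFin {n} f = foldr _ _+_ 0ℚ (map f (allFin n))

-- ∑_{r=a}^{b} f r  (empty when b < a)
ΣRange : ℕ → ℕ → (ℕ → ℚ) → ℚ
ΣRange a b f = List.foldr _+_ 0ℚ (List.map f (List.applyUpTo (a ℕ.+_) (suc b ∸ a)))

-- Bernoulli numbers with te^t/(e^t-1) = ∑ B_n t^n/n!  (so B_1 = +1/2).
-- Comparing coefficients of t^(n+1) in t e^t = (e^t - 1) · ∑ B_j t^j/j! gives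
--   ∑_{j=0}^{n} C(n+1,j) B_j = n+1,  i.e.
--   B_n = (n+1 - ∑_{j<n} C(n+1,j) B_j) / (n+1).
-- bernoullis n = [B_0, …, B_n]
bernoullis : (n : ℕ) → Vec ℚ (suc n)
bernoullis zero = 1ℚ ∷ []
bernoullis (suc n) = bs ∷ʳ new
  where
  bs = bernoullis n
  new : ℚ
  new = (ℕ→ℚ (suc (suc n)) - ΣFin (λ (j : Fin (suc n)) → ℕ→ℚ (suc (suc n) C toℕ j) * lookup bs j))
        * ((+ 1) / suc (suc n))

B : ℕ → ℚ
B n = last (bernoullis n)

-- Euler numbers with 2/(e^t+e^{-t}) = ∑ E_k t^k/k!.
-- Comparing coefficients of t^n in cosh(t) · ∑ E_k t^k/k! = 1 gives
--   ∑_{j even, 0≤j≤n} C(n,j) E_{n-j} = [n = 0], i.e. for n ≥ 1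
--   E_n = - ∑_{i<n, n-i even} C(n, n-i) E_i.
-- eulers n = [E_0, …, E_n]
eulers : (n : ℕ) → Vec ℚ (suc n)
eulers zero = 1ℚ ∷ []
eulers (suc m) = es ∷ʳ new
  where
  es = eulers m
  new : ℚ
  new = - ΣFin (λ (i : Fin (suc m)) →
          if ((suc m ∸ toℕ i) ℕ.% 2) ℕ.≡ᵇ 0
          then ℕ→ℚ (suc m C (suc m ∸ toℕ i)) * lookup es i
          else 0ℚ)

E : ℕ → ℚ
E n = last (eulers n)

2≤⇒NonZero : ∀ {k} → 2 ≤ k → NonZero k
2≤⇒NonZero (s≤s _) = _

module Submission where

-- Work with exponential generating functions over ℚ. Writing β(t) = t eᵗ/(eᵗ − 1) for the series
-- of the Bₙ and sech t for that of the Eₙ, one has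
--   β(4t) − β(2t) = t eᵗ / cosh t = t (1 + tanh t)   and   tanh′ = sech²,
-- so comparing coefficients of tᵏ/k! gives (4ᵏ − 2ᵏ) Bₖ = k · (sech²)₍ₖ₋₂₎, and (sech²)₍ₖ₋₂₎ is
-- the binomial convolution Σᵣ C(k−2, r−1) E₍ₖ₋ᵣ₋₁₎ E₍ᵣ₋₁₎. After clearing denominators, each
-- identity between series is a polynomial consequence of β(t)(eᵗ − 1) = t eᵗ, sech t · cosh t = 1
-- and cosh² − sinh² = 1; the denominators can then be cancelled because e^{4t} − 1 has order
-- exactly one.

open import Defs
open import Relation.Binary.PropositionalEquality
  using (_≡_; _≢_; _≗_; refl; sym; trans; cong; cong₂; module ≡-Reasoning)
import Relation.Binary.Reasoning.Setoid as SetoidReasoning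
open import Function using (_∘_)
open import Data.Bool using (true; false; if_then_else_)
open import Data.Product using (_,_; ∃)
open import Data.Maybe as Maybe using (Maybe)
open import Relation.Nullary.Decidable using (dec⇒maybe)
open import Data.Nat as ℕ using (ℕ; zero; suc; _≤_; _∸_; _^_; s≤s; z≤n)
import Data.Nat.Properties as ℕ
open import Data.Nat.Properties using (m^n≢0)
open import Data.Nat.Combinatorics using (_C_; nCn≡1; nC1≡n; nCk≡nC[n∸k]; nCk+nC[k+1]≡[n+1]C[k+1])
open import Data.Nat.Combinatorics.Specification using (k>n⇒nCk≡0)
import Data.Nat.Coprimality as Coprimality
open import Data.Nat.Induction using (<-rec)
open import Data.Integer as ℤ using (+_)
import Data.Integer.Properties as ℤ
open import Data.Rational
  using (ℚ; mkℚ; 0ℚ; 1ℚ; _+_; _*_; _-_; -_; _/_; 1/_; _≟_; ≢-nonZero; +-*-rawRing)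
open import Data.Rational.Properties
import Data.List as List
open import Data.Vec using (Vec; []; _∷_; _∷ʳ_; lookup; last; foldr; tabulate)
open import Data.Vec.Properties using (last-∷ʳ; tabulate-allFin)
open import Data.Fin as Fin using (Fin; toℕ; fromℕ; inject₁)
open import Data.Fin.Properties using (toℕ-fromℕ; toℕ-inject₁)
open import Data.Fin.Relation.Unary.Top using (view; ‵fromℕ; ‵inject₁)
open import Algebra.Bundles using (CommutativeMonoid; CommutativeRing)
import Algebra.Properties.CommutativeSemigroup as CommutativeSemigroupProperties
import Algebra.Properties.Group as GroupProperties
open import Algebra.Solver.Ring.AlmostCommutativeRing
  using (fromCommutativeRing; _-Raw-AlmostCommutative⟶_)
open import Tactic.RingSolver using (solve-∀)
import Tactic.RingSolver.Core.AlmostCommutativeRing as Reflective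

module ℚ-+ = CommutativeSemigroupProperties (CommutativeMonoid.commutativeSemigroup +-0-commutativeMonoid)
module ℚ-* = CommutativeSemigroupProperties (CommutativeMonoid.commutativeSemigroup *-1-commutativeMonoid)

ℕ→ℚ≡mkℚ : ∀ n → ℕ→ℚ n ≡ mkℚ (+ n) 0 (Coprimality.sym (Coprimality.1-coprimeTo n))
ℕ→ℚ≡mkℚ n = normalize-coprime (Coprimality.sym (Coprimality.1-coprimeTo n))

ℕ→ℚ-suc : ∀ n → ℕ→ℚ (suc n) ≡ 1ℚ + ℕ→ℚ n
ℕ→ℚ-suc n rewrite ℕ→ℚ≡mkℚ n = /-cong {p₁ = + suc n} {q₁ = 1}
  (cong (λ i → ℤ.1ℤ ℤ.+ i) (sym (trans (ℤ.+◃n≡+n (n ℕ.* 1)) (cong +_ (ℕ.*-identityʳ n))))) refl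

ℕ→ℚ-+ : ∀ m n → ℕ→ℚ (m ℕ.+ n) ≡ ℕ→ℚ m + ℕ→ℚ n
ℕ→ℚ-+ zero    n = sym (+-identityˡ (ℕ→ℚ n))
ℕ→ℚ-+ (suc m) n = begin
  ℕ→ℚ (suc (m ℕ.+ n))     ≡⟨ ℕ→ℚ-suc (m ℕ.+ n) ⟩
  1ℚ + ℕ→ℚ (m ℕ.+ n)      ≡⟨ cong (λ x → 1ℚ + x) (ℕ→ℚ-+ m n) ⟩
  1ℚ + (ℕ→ℚ m + ℕ→ℚ n)    ≡⟨ +-assoc 1ℚ (ℕ→ℚ m) (ℕ→ℚ n) ⟨
  1ℚ + ℕ→ℚ m + ℕ→ℚ n      ≡⟨ cong (_+ ℕ→ℚ n) (ℕ→ℚ-suc m) ⟨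
  ℕ→ℚ (suc m) + ℕ→ℚ n     ∎
  where open ≡-Reasoning

ℕ→ℚ-* : ∀ m n → ℕ→ℚ (m ℕ.* n) ≡ ℕ→ℚ m * ℕ→ℚ n
ℕ→ℚ-* zero    n = sym (*-zeroˡ (ℕ→ℚ n))
ℕ→ℚ-* (suc m) n = begin
  ℕ→ℚ (n ℕ.+ m ℕ.* n)          ≡⟨ ℕ→ℚ-+ n (m ℕ.* n) ⟩
  ℕ→ℚ n + ℕ→ℚ (m ℕ.* n)        ≡⟨ cong (λ x → ℕ→ℚ n + x) (ℕ→ℚ-* m n) ⟩
  ℕ→ℚ n + ℕ→ℚ m * ℕ→ℚ n        ≡⟨ cong (_+ ℕ→ℚ m * ℕ→ℚ n) (*-identityˡ (ℕ→ℚ n)) ⟨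
  1ℚ * ℕ→ℚ n + ℕ→ℚ m * ℕ→ℚ n   ≡⟨ *-distribʳ-+ (ℕ→ℚ n) 1ℚ (ℕ→ℚ m) ⟨
  (1ℚ + ℕ→ℚ m) * ℕ→ℚ n         ≡⟨ cong (_* ℕ→ℚ n) (ℕ→ℚ-suc m) ⟨
  ℕ→ℚ (suc m) * ℕ→ℚ n          ∎
  where open ≡-Reasoning

ℕ→ℚ-suc≢0 : ∀ n → ℕ→ℚ (suc n) ≢ 0ℚ
ℕ→ℚ-suc≢0 n eq with trans (sym (ℕ→ℚ≡mkℚ (suc n))) eq
... | ()

1/n*n≡1 : ∀ n .{{_ : ℕ.NonZero n}} → + 1 / n * ℕ→ℚ n ≡ 1ℚ
1/n*n≡1 (suc n) rewrite ℕ→ℚ≡mkℚ (suc n) =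
  trans (cong (_* q) (normalize-coprime (Coprimality.1-coprimeTo (suc n)))) (*-inverseˡ q)
  where
  q : ℚ
  q = mkℚ (+ suc n) 0 (Coprimality.sym (Coprimality.1-coprimeTo (suc n)))

p*q≡0⇒p≡0 : ∀ p q → q ≢ 0ℚ → p * q ≡ 0ℚ → p ≡ 0ℚ
p*q≡0⇒p≡0 p q q≢0 pq≡0 = begin
  p                ≡⟨ *-identityʳ p ⟨
  p * 1ℚ           ≡⟨ cong (p *_) (*-inverseʳ q) ⟨
  p * (q * 1/ q)   ≡⟨ *-assoc p q (1/ q) ⟨
  p * q * 1/ q     ≡⟨ cong (_* 1/ q) pq≡0 ⟩
  0ℚ * 1/ q        ≡⟨ *-zeroˡ (1/ q) ⟩
  0ℚ               ∎
  where
  open ≡-Reasoning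
  instance _ = ≢-nonZero q≢0

sum< : ℕ → (ℕ → ℚ) → ℚ
sum< zero    h = 0ℚ
sum< (suc n) h = h 0 + sum< n (h ∘ suc)

sum<-cong : ∀ n {h h′} → (∀ j → j ℕ.< n → h j ≡ h′ j) → sum< n h ≡ sum< n h′
sum<-cong zero    h≗h′ = refl
sum<-cong (suc n) h≗h′ = cong₂ _+_ (h≗h′ 0 (s≤s z≤n)) (sum<-cong n (λ j j<n → h≗h′ (suc j) (s≤s j<n)))

sum<-zero : ∀ n h → (∀ j → j ℕ.< n → h j ≡ 0ℚ) → sum< n h ≡ 0ℚ
sum<-zero n h h≗0 = trans (sum<-cong n h≗0) (zeros n)
  where
  zeros : ∀ n → sum< n (λ _ → 0ℚ) ≡ 0ℚ
  zeros zero    = refl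
  zeros (suc n) = trans (+-identityˡ _) (zeros n)

sum<-snoc : ∀ n h → sum< (suc n) h ≡ sum< n h + h n
sum<-snoc zero    h = trans (+-identityʳ (h 0)) (sym (+-identityˡ (h 0)))
sum<-snoc (suc n) h = trans (cong (λ x → h 0 + x) (sum<-snoc n (h ∘ suc))) (sym (+-assoc (h 0) _ _))

sum<-+ : ∀ n h h′ → sum< n (λ j → h j + h′ j) ≡ sum< n h + sum< n h′
sum<-+ zero    h h′ = sym (+-identityˡ 0ℚ)
sum<-+ (suc n) h h′ = trans (cong (λ x → h 0 + h′ 0 + x) (sum<-+ n (h ∘ suc) (h′ ∘ suc)))
  (ℚ-+.interchange (h 0) (h′ 0) (sum< n (h ∘ suc)) (sum< n (h′ ∘ suc)))

sum<-foldr : ∀ n (h : Fin n → ℚ) (g : ℕ → ℚ) → (∀ i → h i ≡ g (toℕ i)) →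
  foldr _ _+_ 0ℚ (tabulate h) ≡ sum< n g
sum<-foldr zero    h g h≗g = refl
sum<-foldr (suc n) h g h≗g = cong₂ _+_ (h≗g Fin.zero) (sum<-foldr n (h ∘ Fin.suc) (g ∘ suc) (h≗g ∘ Fin.suc))

ΣFin≡sum< : ∀ n (h : Fin n → ℚ) (g : ℕ → ℚ) → (∀ i → h i ≡ g (toℕ i)) → ΣFin h ≡ sum< n g
ΣFin≡sum< n h g h≗g = trans (cong (foldr _ _+_ 0ℚ) (sym (tabulate-allFin h))) (sum<-foldr n h g h≗g)

ΣRange≡sum< : ∀ a b f → ΣRange a b f ≡ sum< (suc b ∸ a) (λ j → f (a ℕ.+ j))
ΣRange≡sum< a b f = go (suc b ∸ a) (a ℕ.+_)
  where
  go : ∀ n (g : ℕ → ℕ) → List.foldr _+_ 0ℚ (List.map f (List.applyUpTo g n)) ≡ sum< n (f ∘ g)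
  go zero    g = refl
  go (suc n) g = cong (λ x → f (g 0) + x) (go n (g ∘ suc))

-- Exponential generating functions

-- A series f stands for Σₙ f n · tⁿ/n!, so f n is its n-th derivative at 0: differentiation is a
-- shift and the product is defined by the Leibniz rule.
Series : Set
Series = ℕ → ℚ

D : Series → Series
D f n = f (suc n)

𝟎 : Series
𝟎 _ = 0ℚ

κ : ℚ → Series
κ a zero    = a
κ a (suc _) = 0ℚ

-- Defined through κ so that it is, definitionally, the ring solver's constant con 1ℚ.
𝟏 : Series
𝟏 = κ 1ℚ

infixl 6 _⊕_ _⊖_
infixl 7 _⊛_
infixr 8 _·_
infix  8 ⊝_

_⊕_ : Series → Series → Series
(f ⊕ g) n = f n + g n

⊝_ : Series → Series
(⊝ f) n = - f n

_⊖_ : Series → Series → Series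
f ⊖ g = f ⊕ ⊝ g

_·_ : ℚ → Series → Series
(a · f) n = a * f n

_⊛_ : Series → Series → Series
(f ⊛ g) zero    = f 0 * g 0
(f ⊛ g) (suc n) = (D f ⊛ g) n + (f ⊛ D g) n

⊛-cong : ∀ {f f′ g g′} → f ≗ f′ → g ≗ g′ → f ⊛ g ≗ f′ ⊛ g′
⊛-cong f≗f′ g≗g′ zero    = cong₂ _*_ (f≗f′ 0) (g≗g′ 0)
⊛-cong f≗f′ g≗g′ (suc n) = cong₂ _+_ (⊛-cong (f≗f′ ∘ suc) g≗g′ n) (⊛-cong f≗f′ (g≗g′ ∘ suc) n)

⊛-comm : ∀ f g → f ⊛ g ≗ g ⊛ f
⊛-comm f g zero    = *-comm (f 0) (g 0)
⊛-comm f g (suc n) =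
  trans (+-comm ((D f ⊛ g) n) ((f ⊛ D g) n)) (cong₂ _+_ (⊛-comm f (D g) n) (⊛-comm (D f) g n))

⊛-distribʳ : ∀ h f g → (f ⊕ g) ⊛ h ≗ f ⊛ h ⊕ g ⊛ h
⊛-distribʳ h f g zero    = *-distribʳ-+ (h 0) (f 0) (g 0)
⊛-distribʳ h f g (suc n) = trans (cong₂ _+_ (⊛-distribʳ h (D f) (D g) n) (⊛-distribʳ (D h) f g n))
  (ℚ-+.interchange ((D f ⊛ h) n) ((D g ⊛ h) n) ((f ⊛ D h) n) ((g ⊛ D h) n))

⊛-distribˡ : ∀ h f g → h ⊛ (f ⊕ g) ≗ h ⊛ f ⊕ h ⊛ g
⊛-distribˡ h f g n = trans (⊛-comm h (f ⊕ g) n)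
  (trans (⊛-distribʳ h f g n) (cong₂ _+_ (⊛-comm f h n) (⊛-comm g h n)))

⊛-assoc : ∀ f g h → (f ⊛ g) ⊛ h ≗ f ⊛ (g ⊛ h)
⊛-assoc f g h zero    = *-assoc (f 0) (g 0) (h 0)
⊛-assoc f g h (suc n) = begin
  ((D f ⊛ g ⊕ f ⊛ D g) ⊛ h) n + ((f ⊛ g) ⊛ D h) n
    ≡⟨ cong (_+ ((f ⊛ g) ⊛ D h) n) (⊛-distribʳ h (D f ⊛ g) (f ⊛ D g) n) ⟩
  ((D f ⊛ g) ⊛ h) n + ((f ⊛ D g) ⊛ h) n + ((f ⊛ g) ⊛ D h) n
    ≡⟨ cong₂ _+_ (cong₂ _+_ (⊛-assoc (D f) g h n) (⊛-assoc f (D g) h n)) (⊛-assoc f g (D h) n) ⟩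
  (D f ⊛ (g ⊛ h)) n + (f ⊛ (D g ⊛ h)) n + (f ⊛ (g ⊛ D h)) n
    ≡⟨ +-assoc ((D f ⊛ (g ⊛ h)) n) ((f ⊛ (D g ⊛ h)) n) ((f ⊛ (g ⊛ D h)) n) ⟩
  (D f ⊛ (g ⊛ h)) n + ((f ⊛ (D g ⊛ h)) n + (f ⊛ (g ⊛ D h)) n)
    ≡⟨ cong (λ x → (D f ⊛ (g ⊛ h)) n + x) (⊛-distribˡ f (D g ⊛ h) (g ⊛ D h) n) ⟨
  (D f ⊛ (g ⊛ h)) n + (f ⊛ (D g ⊛ h ⊕ g ⊛ D h)) n
    ∎
  where open ≡-Reasoning

⊛-zeroˡ : ∀ g → 𝟎 ⊛ g ≗ 𝟎
⊛-zeroˡ g zero    = *-zeroˡ (g 0)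
⊛-zeroˡ g (suc n) = trans (cong₂ _+_ (⊛-zeroˡ g n) (⊛-zeroˡ (D g) n)) (+-identityˡ 0ℚ)

κ-⊛ : ∀ a g → κ a ⊛ g ≗ a · g
κ-⊛ a g zero    = refl
κ-⊛ a g (suc n) = trans (cong₂ _+_ (⊛-zeroˡ g n) (κ-⊛ a (D g) n)) (+-identityˡ (a * g (suc n)))

⊛-identityˡ : ∀ g → 𝟏 ⊛ g ≗ g
⊛-identityˡ g n = trans (κ-⊛ 1ℚ g n) (*-identityˡ (g n))

·-⊛ : ∀ a f g → a · f ⊛ g ≗ a · (f ⊛ g)
·-⊛ a f g zero    = *-assoc a (f 0) (g 0)
·-⊛ a f g (suc n) =
  trans (cong₂ _+_ (·-⊛ a (D f) g n) (·-⊛ a f (D g) n)) (sym (*-distribˡ-+ a _ _))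

⊛-· : ∀ a f g → f ⊛ a · g ≗ a · (f ⊛ g)
⊛-· a f g n = trans (⊛-comm f (a · g) n) (trans (·-⊛ a g f n) (cong (a *_) (⊛-comm g f n)))

series-commutativeRing : CommutativeRing _ _
series-commutativeRing = record
  { Carrier = Series ; _≈_ = _≗_ ; _+_ = _⊕_ ; _*_ = _⊛_ ; -_ = ⊝_ ; 0# = 𝟎 ; 1# = 𝟏
  ; isCommutativeRing = record
    { isRing = record
      { +-isAbelianGroup = record
        { isGroup = record
          { isMonoid = record
            { isSemigroup = record
              { isMagma = record
                { isEquivalence = record
                  { refl = λ _ → refl ; sym = λ p n → sym (p n) ; trans = λ p q n → trans (p n) (q n) }
                ; ∙-cong = λ p q n → cong₂ _+_ (p n) (q n) }
              ; assoc = λ f g h n → +-assoc (f n) (g n) (h n) }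
            ; identity = (λ f n → +-identityˡ (f n)) , (λ f n → +-identityʳ (f n)) }
          ; inverse = (λ f n → +-inverseˡ (f n)) , (λ f n → +-inverseʳ (f n))
          ; ⁻¹-cong = λ p n → cong -_ (p n) }
        ; comm = λ f g n → +-comm (f n) (g n) }
      ; *-cong = ⊛-cong
      ; *-assoc = ⊛-assoc
      ; *-identity = ⊛-identityˡ , (λ g n → trans (⊛-comm g 𝟏 n) (⊛-identityˡ g n))
      ; distrib = ⊛-distribˡ , ⊛-distribʳ }
    ; *-comm = ⊛-comm } }

module R = CommutativeRing series-commutativeRing
module ≈-Reasoning = SetoidReasoning R.setoid
open GroupProperties R.+-group using (x∙y⁻¹≈ε⇒x≈y; x≈y⇒x∙y⁻¹≈ε)

⊛-≗𝟎 : ∀ u {a} → a ≗ 𝟎 → u ⊛ a ≗ 𝟎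
⊛-≗𝟎 u a≗𝟎 = R.trans (R.*-congˡ a≗𝟎) (R.zeroʳ u)

⊕-≗𝟎 : ∀ {a b} → a ≗ 𝟎 → b ≗ 𝟎 → a ⊕ b ≗ 𝟎
⊕-≗𝟎 a≗𝟎 b≗𝟎 = R.trans (R.+-cong a≗𝟎 b≗𝟎) (R.+-identityˡ 𝟎)

κ-+ : ∀ a b → κ (a + b) ≗ κ a ⊕ κ b
κ-+ a b zero    = refl
κ-+ a b (suc n) = refl

κ-* : ∀ a b → κ (a * b) ≗ κ a ⊛ κ b
κ-* a b n = sym (trans (κ-⊛ a (κ b) n) (a·κb n))
  where
  a·κb : a · κ b ≗ κ (a * b)
  a·κb zero    = refl
  a·κb (suc n) = *-zeroʳ a

κ-‿ : ∀ a → κ (- a) ≗ ⊝ κ a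
κ-‿ a zero    = refl
κ-‿ a (suc n) = refl

κ-0 : κ 0ℚ ≗ 𝟎
κ-0 zero    = refl
κ-0 (suc n) = refl

κ-homomorphism : +-*-rawRing -Raw-AlmostCommutative⟶ fromCommutativeRing series-commutativeRing
κ-homomorphism = record
  { ⟦_⟧ = κ ; +-homo = κ-+ ; *-homo = κ-* ; -‿homo = κ-‿ ; 0-homo = κ-0 ; 1-homo = R.refl }

κ-≟ : ∀ a b → Maybe (κ a ≗ κ b)
κ-≟ a b = Maybe.map (λ a≡b n → cong (λ c → κ c n) a≡b) (dec⇒maybe (a ≟ b))

open import Algebra.Solver.Ring +-*-rawRing (fromCommutativeRing series-commutativeRing) κ-homomorphism κ-≟
  using (solve; _:+_; _:*_; :-_; _:-_; con; _:=_)

binomial : Series → Series → ℕ → ℕ → ℚ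
binomial f g n j = ℕ→ℚ (n C j) * (f j * g (n ∸ j))

binomial-pascal : ∀ f g n j → binomial f g (suc n) (suc j)
  ≡ binomial (D f) g n j + ℕ→ℚ (n C suc j) * (f (suc j) * g (n ∸ j))
binomial-pascal f g n j = begin
  ℕ→ℚ (suc n C suc j) * fg                 ≡⟨ cong (λ c → ℕ→ℚ c * fg) (nCk+nC[k+1]≡[n+1]C[k+1] n j) ⟨
  ℕ→ℚ (n C j ℕ.+ n C suc j) * fg           ≡⟨ cong (_* fg) (ℕ→ℚ-+ (n C j) (n C suc j)) ⟩
  (ℕ→ℚ (n C j) + ℕ→ℚ (n C suc j)) * fg     ≡⟨ *-distribʳ-+ fg (ℕ→ℚ (n C j)) (ℕ→ℚ (n C suc j)) ⟩
  ℕ→ℚ (n C j) * fg + ℕ→ℚ (n C suc j) * fg  ∎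
  where
  open ≡-Reasoning
  fg : ℚ
  fg = f (suc j) * g (n ∸ j)

⊛-binomial : ∀ f g n → (f ⊛ g) n ≡ sum< (suc n) (binomial f g n)
⊛-binomial f g zero    = sym (trans (+-identityʳ _) (*-identityˡ (f 0 * g 0)))
⊛-binomial f g (suc n) = begin
  (D f ⊛ g) n + (f ⊛ D g) n
    ≡⟨ cong₂ _+_ (⊛-binomial (D f) g n) (⊛-binomial f (D g) n) ⟩
  A + (h₀ + sum< n (binomial f (D g) n ∘ suc))
    ≡⟨ cong (λ x → A + (h₀ + x)) (sum<-cong n shift) ⟩
  A + (h₀ + sum< n T)
    ≡⟨ cong (λ x → A + (h₀ + x)) drop-last ⟨
  A + (h₀ + sum< (suc n) T)
    ≡⟨ ℚ-+.x∙yz≈y∙xz A h₀ (sum< (suc n) T) ⟩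
  h₀ + (A + sum< (suc n) T)
    ≡⟨ cong (λ x → h₀ + x) (sum<-+ (suc n) (binomial (D f) g n) T) ⟨
  h₀ + sum< (suc n) (λ j → binomial (D f) g n j + T j)
    ≡⟨ cong (λ x → h₀ + x) (sum<-cong (suc n) (λ j _ → sym (binomial-pascal f g n j))) ⟩
  sum< (suc (suc n)) (binomial f g (suc n))
    ∎
  where
  open ≡-Reasoning
  A h₀ : ℚ
  A = sum< (suc n) (binomial (D f) g n)
  h₀ = binomial f g (suc n) 0
  T : ℕ → ℚ
  T j = ℕ→ℚ (n C suc j) * (f (suc j) * g (n ∸ j))
  shift : ∀ j → j ℕ.< n → binomial f (D g) n (suc j) ≡ T j
  shift j j<n = cong (λ i → ℕ→ℚ (n C suc j) * (f (suc j) * g i)) (sym (ℕ.+-∸-assoc 1 j<n))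
  drop-last : sum< (suc n) T ≡ sum< n T
  drop-last = trans (sum<-snoc n T) (trans (cong (λ x → sum< n T + x) Tₙ≡0) (+-identityʳ (sum< n T)))
    where
    Tₙ≡0 : T n ≡ 0ℚ
    Tₙ≡0 = trans (cong (λ c → ℕ→ℚ c * (f (suc n) * g (n ∸ n))) (k>n⇒nCk≡0 (ℕ.n<1+n n)))
                 (*-zeroˡ (f (suc n) * g (n ∸ n)))

t : Series
t zero    = 0ℚ
t (suc n) = 𝟏 n

t⊛-suc : ∀ f n → (t ⊛ f) (suc n) ≡ ℕ→ℚ (suc n) * f n
t⊛-suc f zero    = trans (cong (λ x → 1ℚ * f 0 + x) (*-zeroˡ (f 1))) (+-identityʳ (1ℚ * f 0))
t⊛-suc f (suc n) = begin
  (𝟏 ⊛ f) (suc n) + (t ⊛ D f) (suc n)       ≡⟨ cong₂ _+_ (⊛-identityˡ f (suc n)) (t⊛-suc (D f) n) ⟩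
  f (suc n) + ℕ→ℚ (suc n) * f (suc n)       ≡⟨ cong (_+ ℕ→ℚ (suc n) * f (suc n)) (*-identityˡ (f (suc n))) ⟨
  1ℚ * f (suc n) + ℕ→ℚ (suc n) * f (suc n)  ≡⟨ *-distribʳ-+ (f (suc n)) 1ℚ (ℕ→ℚ (suc n)) ⟨
  (1ℚ + ℕ→ℚ (suc n)) * f (suc n)            ≡⟨ cong (_* f (suc n)) (ℕ→ℚ-suc (suc n)) ⟨
  ℕ→ℚ (suc (suc n)) * f (suc n)             ∎
  where open ≡-Reasoning

t⊛-cancel : ∀ {f} → t ⊛ f ≗ 𝟎 → f ≗ 𝟎
t⊛-cancel {f} t⊛f≗𝟎 n = p*q≡0⇒p≡0 (f n) (ℕ→ℚ (suc n)) (ℕ→ℚ-suc≢0 n)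
  (trans (*-comm (f n) (ℕ→ℚ (suc n))) (trans (sym (t⊛-suc f n)) (t⊛f≗𝟎 (suc n))))

-- In (f ⊛ q) n the only term that survives once f vanishes below n is f n * q 0.
⊛-cancelʳ-unit : ∀ {f q} → q 0 ≢ 0ℚ → f ⊛ q ≗ 𝟎 → f ≗ 𝟎
⊛-cancelʳ-unit {f} {q} q₀≢0 f⊛q≗𝟎 = <-rec (λ n → f n ≡ 0ℚ) step
  where
  step : ∀ n → (∀ {j} → j ℕ.< n → f j ≡ 0ℚ) → f n ≡ 0ℚ
  step n below = p*q≡0⇒p≡0 (f n) (q 0) q₀≢0 (begin
    f n * q 0                                   ≡⟨ cong (λ i → f n * q i) (ℕ.n∸n≡0 n) ⟨
    f n * q (n ∸ n)                             ≡⟨ *-identityˡ _ ⟨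
    1ℚ * (f n * q (n ∸ n))                      ≡⟨ cong (λ c → ℕ→ℚ c * (f n * q (n ∸ n))) (nCn≡1 n) ⟨
    binomial f q n n                            ≡⟨ +-identityˡ _ ⟨
    0ℚ + binomial f q n n                       ≡⟨ cong (_+ binomial f q n n) (sum<-zero n _ lower-terms) ⟨
    sum< n (binomial f q n) + binomial f q n n  ≡⟨ trans (⊛-binomial f q n) (sum<-snoc n _) ⟨
    (f ⊛ q) n                                   ≡⟨ f⊛q≗𝟎 n ⟩
    0ℚ                                          ∎)
    where
    open ≡-Reasoning
    lower-terms : ∀ j → j ℕ.< n → binomial f q n j ≡ 0ℚ
    lower-terms j j<n = trans (cong (λ a → ℕ→ℚ (n C j) * (a * q (n ∸ j))) (below j<n))
      (trans (cong (ℕ→ℚ (n C j) *_) (*-zeroˡ (q (n ∸ j)))) (*-zeroʳ (ℕ→ℚ (n C j))))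

-- Such a g is t ⊛ q with q 0 ≢ 0, and both factors can be cancelled.
⊛-cancelʳ-order₁ : ∀ {f g} → g 0 ≡ 0ℚ → g 1 ≢ 0ℚ → f ⊛ g ≗ 𝟎 → f ≗ 𝟎
⊛-cancelʳ-order₁ {f} {g} g₀≡0 g₁≢0 f⊛g≗𝟎 = ⊛-cancelʳ-unit q₀≢0 (t⊛-cancel (begin
  t ⊛ (f ⊛ q)  ≈⟨ solve 3 (λ t f q → t :* (f :* q) := f :* (t :* q)) R.refl t f q ⟩
  f ⊛ (t ⊛ q)  ≈⟨ R.*-congˡ {f} (R.sym g≗t⊛q) ⟩
  f ⊛ g        ≈⟨ f⊛g≗𝟎 ⟩
  𝟎            ∎))
  where
  open ≈-Reasoning
  q : Series
  q n = (1/ ℕ→ℚ (suc n)) {{≢-nonZero (ℕ→ℚ-suc≢0 n)}} * g (suc n)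
  q-suc : ∀ n → ℕ→ℚ (suc n) * q n ≡ g (suc n)
  q-suc n = trans (sym (*-assoc (ℕ→ℚ (suc n)) _ (g (suc n))))
    (trans (cong (_* g (suc n)) (*-inverseʳ (ℕ→ℚ (suc n)))) (*-identityˡ (g (suc n))))
    where instance _ = ≢-nonZero (ℕ→ℚ-suc≢0 n)
  g≗t⊛q : g ≗ t ⊛ q
  g≗t⊛q zero    = trans g₀≡0 (sym (*-zeroˡ (q 0)))
  g≗t⊛q (suc n) = sym (trans (t⊛-suc q n) (q-suc n))
  q₀≢0 : q 0 ≢ 0ℚ
  q₀≢0 q₀≡0 = g₁≢0 (trans (sym (q-suc 0)) (trans (cong (ℕ→ℚ 1 *_) q₀≡0) (*-zeroʳ (ℕ→ℚ 1))))

pow : ℚ → ℕ → ℚ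
pow a zero    = 1ℚ
pow a (suc n) = a * pow a n

exp : ℚ → Series
exp a n = pow a n

exp-+ : ∀ a b → exp a ⊛ exp b ≗ exp (a + b)
exp-+ a b zero    = *-identityˡ 1ℚ
exp-+ a b (suc n) = begin
  (a · exp a ⊛ exp b) n + (exp a ⊛ b · exp b) n  ≡⟨ cong₂ _+_ (·-⊛ a (exp a) (exp b) n) (⊛-· b (exp a) (exp b) n) ⟩
  a * (exp a ⊛ exp b) n + b * (exp a ⊛ exp b) n  ≡⟨ *-distribʳ-+ _ a b ⟨
  (a + b) * (exp a ⊛ exp b) n                    ≡⟨ cong ((a + b) *_) (exp-+ a b n) ⟩
  (a + b) * pow (a + b) n                        ∎
  where open ≡-Reasoning

pow-1 : ∀ n → pow 1ℚ n ≡ 1ℚ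
pow-1 zero    = refl
pow-1 (suc n) = trans (*-identityˡ (pow 1ℚ n)) (pow-1 n)

pow-ℕ→ℚ : ∀ a n → pow (ℕ→ℚ a) n ≡ ℕ→ℚ (a ^ n)
pow-ℕ→ℚ a zero    = refl
pow-ℕ→ℚ a (suc n) = trans (cong (ℕ→ℚ a *_) (pow-ℕ→ℚ a n)) (sym (ℕ→ℚ-* a (a ^ n)))

-- scale a f is the series of f(a t).
scale : ℚ → Series → Series
scale a f n = pow a n * f n

scale-⊛ : ∀ a f g → scale a (f ⊛ g) ≗ scale a f ⊛ scale a g
scale-⊛ a f g zero    = sym (ℚ-*.interchange 1ℚ (f 0) 1ℚ (g 0))
scale-⊛ a f g (suc n) = sym (begin
  (D (scale a f) ⊛ scale a g) n + (scale a f ⊛ D (scale a g)) n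
    ≡⟨ cong₂ _+_ (⊛-cong (D-scale f) (λ _ → refl) n) (⊛-cong {scale a f} (λ _ → refl) (D-scale g) n) ⟩
  (a · scale a (D f) ⊛ scale a g) n + (scale a f ⊛ a · scale a (D g)) n
    ≡⟨ cong₂ _+_ (·-⊛ a (scale a (D f)) (scale a g) n) (⊛-· a (scale a f) (scale a (D g)) n) ⟩
  a * (scale a (D f) ⊛ scale a g) n + a * (scale a f ⊛ scale a (D g)) n
    ≡⟨ cong₂ (λ u v → a * u + a * v) (scale-⊛ a (D f) g n) (scale-⊛ a f (D g) n) ⟨
  a * (pow a n * (D f ⊛ g) n) + a * (pow a n * (f ⊛ D g) n)
    ≡⟨ *-distribˡ-+ a _ _ ⟨
  a * (pow a n * (D f ⊛ g) n + pow a n * (f ⊛ D g) n)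
    ≡⟨ cong (a *_) (*-distribˡ-+ (pow a n) _ _) ⟨
  a * (pow a n * (f ⊛ g) (suc n))
    ≡⟨ *-assoc a (pow a n) _ ⟨
  scale a (f ⊛ g) (suc n)
    ∎)
  where
  open ≡-Reasoning
  D-scale : ∀ h → D (scale a h) ≗ a · scale a (D h)
  D-scale h m = *-assoc a (pow a m) (h (suc m))

scale-⊖ : ∀ a f g → scale a (f ⊖ g) ≗ scale a f ⊖ scale a g
scale-⊖ a f g n = trans (*-distribˡ-+ (pow a n) (f n) (- g n))
  (cong (λ x → pow a n * f n + x) (sym (neg-distribʳ-* (pow a n) (g n))))

scale-exp : ∀ a b → scale a (exp b) ≗ exp (a * b)
scale-exp a b zero    = *-identityˡ 1ℚ
scale-exp a b (suc n) =
  trans (ℚ-*.interchange a (pow a n) b (pow b n)) (cong ((a * b) *_) (scale-exp a b n))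

scale-𝟏 : ∀ a → scale a 𝟏 ≗ 𝟏
scale-𝟏 a zero    = *-identityˡ 1ℚ
scale-𝟏 a (suc n) = *-zeroʳ (pow a (suc n))

scale-t : ∀ a → scale a t ≗ a · t
scale-t a zero          = trans (*-zeroʳ 1ℚ) (sym (*-zeroʳ a))
scale-t a (suc zero)    = *-identityʳ (a * 1ℚ)
scale-t a (suc (suc n)) = trans (*-zeroʳ (pow a (suc (suc n)))) (sym (*-zeroʳ a))

cosh sinh : Series
cosh zero    = 1ℚ
cosh (suc n) = sinh n
sinh zero    = 0ℚ
sinh (suc n) = cosh n

cosh-parity : ∀ n → cosh n ≡ (if n ℕ.% 2 ℕ.≡ᵇ 0 then 1ℚ else 0ℚ)
cosh-parity zero          = refl
cosh-parity (suc zero)    = refl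
cosh-parity (suc (suc n)) = cosh-parity n

cosh⊕sinh≗exp : cosh ⊕ sinh ≗ exp 1ℚ
cosh⊕sinh≗exp zero    = refl
cosh⊕sinh≗exp (suc n) =
  trans (+-comm (sinh n) (cosh n)) (trans (cosh⊕sinh≗exp n) (sym (*-identityˡ (pow 1ℚ n))))

D≗𝟎⇒≗κ : ∀ {f} → D f ≗ 𝟎 → f ≗ κ (f 0)
D≗𝟎⇒≗κ Df≗𝟎 zero    = refl
D≗𝟎⇒≗κ Df≗𝟎 (suc n) = Df≗𝟎 n

-- Its derivative is sinh ⊛ cosh ⊕ cosh ⊛ sinh ⊖ (cosh ⊛ sinh ⊕ sinh ⊛ cosh).
cosh²⊖sinh²≗𝟏 : cosh ⊛ cosh ⊖ sinh ⊛ sinh ≗ 𝟏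
cosh²⊖sinh²≗𝟏 = D≗𝟎⇒≗κ (x≈y⇒x∙y⁻¹≈ε (R.+-cong (⊛-comm sinh cosh) (⊛-comm cosh sinh)))

-- Bernoulli and Euler numbers

module _ {A : Set} where

  lookup-∷ʳ-fromℕ : ∀ {n} (xs : Vec A n) y → lookup (xs ∷ʳ y) (fromℕ n) ≡ y
  lookup-∷ʳ-fromℕ []       y = refl
  lookup-∷ʳ-fromℕ (x ∷ xs) y = lookup-∷ʳ-fromℕ xs y

  lookup-∷ʳ-inject₁ : ∀ {n} (xs : Vec A n) y i → lookup (xs ∷ʳ y) (inject₁ i) ≡ lookup xs i
  lookup-∷ʳ-inject₁ (x ∷ xs) y Fin.zero    = refl
  lookup-∷ʳ-inject₁ (x ∷ xs) y (Fin.suc i) = lookup-∷ʳ-inject₁ xs y i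

  lookup≡last-of-prefix : (v : ∀ n → Vec A (suc n)) → (∀ n → ∃ λ y → v (suc n) ≡ v n ∷ʳ y) →
    ∀ n i → lookup (v n) i ≡ last (v (toℕ i))
  lookup≡last-of-prefix v extends zero    Fin.zero with v 0
  ... | a ∷ [] = refl
  lookup≡last-of-prefix v extends (suc n) i with extends n | view i
  ... | y , v₊≡ | ‵fromℕ = begin
    lookup (v (suc n)) (fromℕ (suc n))  ≡⟨ cong (λ w → lookup w (fromℕ (suc n))) v₊≡ ⟩
    lookup (v n ∷ʳ y) (fromℕ (suc n))   ≡⟨ lookup-∷ʳ-fromℕ (v n) y ⟩
    y                                   ≡⟨ last-∷ʳ y (v n) ⟨
    last (v n ∷ʳ y)                     ≡⟨ cong last v₊≡ ⟨
    last (v (suc n))                    ≡⟨ cong (λ m → last (v m)) (toℕ-fromℕ (suc n)) ⟨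
    last (v (toℕ (fromℕ (suc n))))      ∎
    where open ≡-Reasoning
  ... | y , v₊≡ | ‵inject₁ j = begin
    lookup (v (suc n)) (inject₁ j)      ≡⟨ cong (λ w → lookup w (inject₁ j)) v₊≡ ⟩
    lookup (v n ∷ʳ y) (inject₁ j)       ≡⟨ lookup-∷ʳ-inject₁ (v n) y j ⟩
    lookup (v n) j                      ≡⟨ lookup≡last-of-prefix v extends n j ⟩
    last (v (toℕ j))                    ≡⟨ cong (λ m → last (v m)) (toℕ-inject₁ j) ⟨
    last (v (toℕ (inject₁ j)))          ∎
    where open ≡-Reasoning

lookup-bernoullis : ∀ n i → lookup (bernoullis n) i ≡ B (toℕ i)
lookup-bernoullis = lookup≡last-of-prefix bernoullis (λ _ → _ , refl)

lookup-eulers : ∀ n i → lookup (eulers n) i ≡ E (toℕ i)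
lookup-eulers = lookup≡last-of-prefix eulers (λ _ → _ , refl)

bernoulli-recurrence : ∀ m → sum< (suc m) (λ j → ℕ→ℚ (suc m C j) * B j) ≡ ℕ→ℚ (suc m)
bernoulli-recurrence zero    = refl
bernoulli-recurrence (suc n) = begin
  sum< (suc (suc n)) h                        ≡⟨ sum<-snoc (suc n) h ⟩
  Σ + ℕ→ℚ (suc (suc n) C suc n) * B (suc n)  ≡⟨ cong (λ c → Σ + ℕ→ℚ c * B (suc n)) [n+2]C[n+1]≡n+2 ⟩
  Σ + P * B (suc n)                          ≡⟨ cong (λ b → Σ + P * b) B₊≡ ⟩
  Σ + P * ((P - Σ) * I)                      ≡⟨ cong (λ x → Σ + x) (ℚ-*.x∙yz≈y∙zx P (P - Σ) I) ⟩
  Σ + (P - Σ) * (I * P)                      ≡⟨ cong (λ x → Σ + (P - Σ) * x) (1/n*n≡1 (suc (suc n))) ⟩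
  Σ + (P - Σ) * 1ℚ                           ≡⟨ cong (λ x → Σ + x) (*-identityʳ (P - Σ)) ⟩
  Σ + (P - Σ)                                ≡⟨ ℚ-+.x∙yz≈y∙xz Σ P (- Σ) ⟩
  P + (Σ - Σ)                                ≡⟨ cong (λ x → P + x) (+-inverseʳ Σ) ⟩
  P + 0ℚ                                     ≡⟨ +-identityʳ P ⟩
  P                                          ∎
  where
  open ≡-Reasoning
  h : ℕ → ℚ
  h j = ℕ→ℚ (suc (suc n) C j) * B j
  Σ P I : ℚ
  Σ = sum< (suc n) h
  P = ℕ→ℚ (suc (suc n))
  I = + 1 / suc (suc n)
  [n+2]C[n+1]≡n+2 : suc (suc n) C suc n ≡ suc (suc n)
  [n+2]C[n+1]≡n+2 = trans (nCk≡nC[n∸k] (ℕ.n≤1+n (suc n)))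
    (trans (cong (suc (suc n) C_) (ℕ.m+n∸n≡m 1 n)) (nC1≡n (suc (suc n))))
  B₊≡ : B (suc n) ≡ (P - Σ) * I
  B₊≡ = trans (last-∷ʳ _ (bernoullis n)) (cong (λ s → (P - s) * I)
    (ΣFin≡sum< (suc n) _ h (λ i → cong (ℕ→ℚ (suc (suc n) C toℕ i) *_) (lookup-bernoullis n i))))

B⊛exp1 : ∀ n → (B ⊛ exp 1ℚ) n ≡ B n + (t ⊛ exp 1ℚ) n
B⊛exp1 n = begin
  (B ⊛ exp 1ℚ) n                                           ≡⟨ trans (⊛-binomial B (exp 1ℚ) n) (sum<-snoc n _) ⟩
  sum< n (binomial B (exp 1ℚ) n) + binomial B (exp 1ℚ) n n  ≡⟨ cong₂ _+_ (lower n) top ⟩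
  (t ⊛ exp 1ℚ) n + B n                                     ≡⟨ +-comm _ (B n) ⟩
  B n + (t ⊛ exp 1ℚ) n                                     ∎
  where
  open ≡-Reasoning
  binomial≡ : ∀ m j → binomial B (exp 1ℚ) m j ≡ ℕ→ℚ (m C j) * B j
  binomial≡ m j = cong (ℕ→ℚ (m C j) *_) (trans (cong (B j *_) (pow-1 (m ∸ j))) (*-identityʳ (B j)))
  top : binomial B (exp 1ℚ) n n ≡ B n
  top = trans (binomial≡ n n) (trans (cong (λ c → ℕ→ℚ c * B n) (nCn≡1 n)) (*-identityˡ (B n)))
  lower : ∀ n → sum< n (binomial B (exp 1ℚ) n) ≡ (t ⊛ exp 1ℚ) n
  lower zero    = refl
  lower (suc m) = begin
    sum< (suc m) (binomial B (exp 1ℚ) (suc m))  ≡⟨ sum<-cong (suc m) (λ j _ → binomial≡ (suc m) j) ⟩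
    sum< (suc m) (λ j → ℕ→ℚ (suc m C j) * B j)  ≡⟨ bernoulli-recurrence m ⟩
    ℕ→ℚ (suc m)                                 ≡⟨ *-identityʳ _ ⟨
    ℕ→ℚ (suc m) * 1ℚ                            ≡⟨ cong (ℕ→ℚ (suc m) *_) (pow-1 m) ⟨
    ℕ→ℚ (suc m) * exp 1ℚ m                      ≡⟨ t⊛-suc (exp 1ℚ) m ⟨
    (t ⊛ exp 1ℚ) (suc m)                        ∎

bernoulli-egf : B ⊛ (exp 1ℚ ⊖ 𝟏) ≗ t ⊛ exp 1ℚ
bernoulli-egf = begin
  B ⊛ (exp 1ℚ ⊖ 𝟏)            ≈⟨ solve 2 (λ B e → B :* (e :- con 1ℚ) := B :* e :- B) R.refl B (exp 1ℚ) ⟩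
  B ⊛ exp 1ℚ ⊖ B              ≈⟨ R.+-congʳ B⊛exp1 ⟩
  B ⊕ t ⊛ exp 1ℚ ⊖ B          ≈⟨ solve 2 (λ B te → B :+ te :- B := te) R.refl B (t ⊛ exp 1ℚ) ⟩
  t ⊛ exp 1ℚ                  ∎
  where open ≈-Reasoning

bernoulli-egf-scaled : ∀ a → scale a B ⊛ (exp a ⊖ 𝟏) ≗ κ a ⊛ (t ⊛ exp a)
bernoulli-egf-scaled a = begin
  scale a B ⊛ (exp a ⊖ 𝟏)                ≈⟨ R.*-congˡ (R.+-cong (R.sym scale-e) (R.-‿cong (R.sym (scale-𝟏 a)))) ⟩
  scale a B ⊛ (scale a e ⊖ scale a 𝟏)    ≈⟨ R.*-congˡ (R.sym (scale-⊖ a e 𝟏)) ⟩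
  scale a B ⊛ scale a (e ⊖ 𝟏)            ≈⟨ R.sym (scale-⊛ a B (e ⊖ 𝟏)) ⟩
  scale a (B ⊛ (e ⊖ 𝟏))                  ≈⟨ (λ n → cong (pow a n *_) (bernoulli-egf n)) ⟩
  scale a (t ⊛ e)                        ≈⟨ scale-⊛ a t e ⟩
  scale a t ⊛ scale a e                  ≈⟨ R.*-cong (R.trans (scale-t a) (R.sym (κ-⊛ a t))) scale-e ⟩
  κ a ⊛ t ⊛ exp a                        ≈⟨ ⊛-assoc (κ a) t (exp a) ⟩
  κ a ⊛ (t ⊛ exp a)                      ∎
  where
  open ≈-Reasoning
  e : Series
  e = exp 1ℚ
  scale-e : scale a e ≗ exp a
  scale-e n = trans (scale-exp a 1ℚ n) (cong (λ b → pow b n) (*-identityʳ a))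

euler-egf : E ⊛ cosh ≗ 𝟏
euler-egf zero    = refl
euler-egf (suc m) = begin
  (E ⊛ cosh) (suc m)
    ≡⟨ trans (⊛-binomial E cosh (suc m)) (sum<-snoc (suc m) (binomial E cosh (suc m))) ⟩
  sum< (suc m) (binomial E cosh (suc m)) + binomial E cosh (suc m) (suc m)
    ≡⟨ cong₂ _+_ (sum<-cong (suc m) lower) top ⟩
  sum< (suc m) h + E (suc m)
    ≡⟨ cong (λ x → sum< (suc m) h + x) E₊≡ ⟩
  sum< (suc m) h - sum< (suc m) h
    ≡⟨ +-inverseʳ (sum< (suc m) h) ⟩
  0ℚ
    ∎
  where
  open ≡-Reasoning
  term : ℕ → ℚ → ℚ
  term j e = if (suc m ∸ j) ℕ.% 2 ℕ.≡ᵇ 0 then ℕ→ℚ (suc m C (suc m ∸ j)) * e else 0ℚ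
  h : ℕ → ℚ
  h j = term j (E j)
  E₊≡ : E (suc m) ≡ - sum< (suc m) h
  E₊≡ = trans (last-∷ʳ _ (eulers m))
    (cong -_ (ΣFin≡sum< (suc m) _ h (λ i → cong (term (toℕ i)) (lookup-eulers m i))))
  top : binomial E cosh (suc m) (suc m) ≡ E (suc m)
  top = trans (cong₂ (λ c i → ℕ→ℚ c * (E (suc m) * cosh i)) (nCn≡1 (suc m)) (ℕ.n∸n≡0 (suc m)))
              (trans (*-identityˡ _) (*-identityʳ (E (suc m))))
  lower : ∀ j → j ℕ.< suc m → binomial E cosh (suc m) j ≡ h j
  lower j j<1+m rewrite cosh-parity (suc m ∸ j) with (suc m ∸ j) ℕ.% 2 ℕ.≡ᵇ 0
  ... | true  = trans (cong (ℕ→ℚ (suc m C j) *_) (*-identityʳ (E j)))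
                      (cong (λ c → ℕ→ℚ c * E j) (nCk≡nC[n∸k] (ℕ.<⇒≤ j<1+m)))
  ... | false = trans (cong (ℕ→ℚ (suc m C j) *_) (*-zeroʳ (E j))) (*-zeroʳ (ℕ→ℚ (suc m C j)))

D-euler-egf : D E ⊛ cosh ⊕ E ⊛ sinh ≗ 𝟎
D-euler-egf = euler-egf ∘ suc

-- tanh and sech²

exp1⁴≗exp4 : exp 1ℚ ⊛ exp 1ℚ ⊛ (exp 1ℚ ⊛ exp 1ℚ) ≗ exp (ℕ→ℚ 4)
exp1⁴≗exp4 = R.trans (R.*-cong (exp-+ 1ℚ 1ℚ) (exp-+ 1ℚ 1ℚ)) (exp-+ (ℕ→ℚ 2) (ℕ→ℚ 2))

-- Multiplied by e⁴ − 1 = (e² − 1)(e² + 1), with e = eᵗ, both Bernoulli series become polynomials in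
-- t and e, and what is left is 2e cosh = e² + 1, which follows from e = cosh + sinh and cosh² − sinh² = 1.
bernoulli-difference : (scale (ℕ→ℚ 4) B ⊖ scale (ℕ→ℚ 2) B) ⊛ cosh ≗ t ⊛ exp 1ℚ
bernoulli-difference = x∙y⁻¹≈ε⇒x≈y _ _ (⊛-cancelʳ-order₁ {g = exp (ℕ→ℚ 4) ⊖ 𝟏} refl (λ ()) (R.trans
  (R.*-congˡ (R.+-congʳ (R.sym exp1⁴≗exp4)))
  (R.trans
    (solve 6 (λ Q P x e c s →
       ((Q :- P) :* c :- x :* e) :* (e :* e :* (e :* e) :- con 1ℚ)
       := c :* (Q :* (e :* e :* (e :* e) :- con 1ℚ) :- con (ℕ→ℚ 4) :* (x :* (e :* e :* (e :* e))))
       :+ (:- (c :* (e :* e :+ con 1ℚ))) :* (P :* (e :* e :- con 1ℚ) :- con (ℕ→ℚ 2) :* (x :* (e :* e)))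
       :+ x :* e :* (e :* e :- con 1ℚ) :* (c :* c :- s :* s :- con 1ℚ)
       :+ x :* e :* (e :* e :- con 1ℚ) :* (con (ℕ→ℚ 2) :* s :- (c :+ s :- e)) :* (c :+ s :- e))
     R.refl (scale (ℕ→ℚ 4) B) (scale (ℕ→ℚ 2) B) t (exp 1ℚ) cosh sinh)
    (⊕-≗𝟎 (⊕-≗𝟎 (⊕-≗𝟎 (⊛-≗𝟎 _ (x≈y⇒x∙y⁻¹≈ε (scaled (ℕ→ℚ 4) exp1⁴≗exp4)))
                       (⊛-≗𝟎 _ (x≈y⇒x∙y⁻¹≈ε (scaled (ℕ→ℚ 2) (exp-+ 1ℚ 1ℚ)))))
                (⊛-≗𝟎 _ (x≈y⇒x∙y⁻¹≈ε cosh²⊖sinh²≗𝟏)))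
          (⊛-≗𝟎 _ (x≈y⇒x∙y⁻¹≈ε cosh⊕sinh≗exp))))))
  where
  scaled : ∀ a {eₐ} → eₐ ≗ exp a → scale a B ⊛ (eₐ ⊖ 𝟏) ≗ κ a ⊛ (t ⊛ eₐ)
  scaled a eₐ≗ = R.trans (R.*-congˡ (R.+-congʳ eₐ≗))
    (R.trans (bernoulli-egf-scaled a) (R.*-congˡ (R.*-congˡ (R.sym eₐ≗))))

tanh : Series
tanh = sinh ⊛ E

t⊛tanh : t ⊛ tanh ≗ scale (ℕ→ℚ 4) B ⊖ scale (ℕ→ℚ 2) B ⊖ t
t⊛tanh = x∙y⁻¹≈ε⇒x≈y _ _ (R.trans
  (solve 7 (λ Q P x e c s ε →
     x :* (s :* ε) :- (Q :- P :- x)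
     := (Q :- P :- x) :* (ε :* c :- con 1ℚ)
     :+ (:- ε) :* ((Q :- P) :* c :- x :* e)
     :+ ε :* x :* (c :+ s :- e))
   R.refl (scale (ℕ→ℚ 4) B) (scale (ℕ→ℚ 2) B) t (exp 1ℚ) cosh sinh E)
  (⊕-≗𝟎 (⊕-≗𝟎 (⊛-≗𝟎 _ (x≈y⇒x∙y⁻¹≈ε euler-egf)) (⊛-≗𝟎 _ (x≈y⇒x∙y⁻¹≈ε bernoulli-difference)))
        (⊛-≗𝟎 _ (x≈y⇒x∙y⁻¹≈ε cosh⊕sinh≗exp))))

D-tanh : D tanh ≗ E ⊛ E
D-tanh = x∙y⁻¹≈ε⇒x≈y _ _ (R.trans
  (solve 4 (λ c s ε ε′ →
     c :* ε :+ s :* ε′ :- ε :* ε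
     := ε :* ε :* (c :* c :- s :* s :- con 1ℚ)
     :+ s :* ε :* (ε′ :* c :+ ε :* s)
     :+ (:- (s :* ε′ :+ c :* ε)) :* (ε :* c :- con 1ℚ))
   R.refl cosh sinh E (D E))
  (⊕-≗𝟎 (⊕-≗𝟎 (⊛-≗𝟎 _ (x≈y⇒x∙y⁻¹≈ε cosh²⊖sinh²≗𝟏)) (⊛-≗𝟎 _ D-euler-egf))
        (⊛-≗𝟎 _ (x≈y⇒x∙y⁻¹≈ε euler-egf))))

sech²-coefficient : ∀ m → let k = suc (suc m) in
  ℕ→ℚ k * (E ⊛ E) m ≡ pow (ℕ→ℚ 4) k * B k - pow (ℕ→ℚ 2) k * B k
sech²-coefficient m = begin
  ℕ→ℚ k * (E ⊛ E) m                               ≡⟨ cong (ℕ→ℚ k *_) (D-tanh m) ⟨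
  ℕ→ℚ k * tanh (suc m)                            ≡⟨ t⊛-suc tanh (suc m) ⟨
  (t ⊛ tanh) k                                    ≡⟨ t⊛tanh k ⟩
  pow (ℕ→ℚ 4) k * B k - pow (ℕ→ℚ 2) k * B k + 0ℚ  ≡⟨ +-identityʳ _ ⟩
  pow (ℕ→ℚ 4) k * B k - pow (ℕ→ℚ 2) k * B k       ∎
  where
  open ≡-Reasoning
  k : ℕ
  k = suc (suc m)

ΣRange≡⊛ : ∀ f g m →
  ΣRange 1 (suc m) (λ r → ℕ→ℚ (m C (r ∸ 1)) * f (suc (suc m) ∸ r ∸ 1) * g (r ∸ 1)) ≡ (g ⊛ f) m
ΣRange≡⊛ f g m = begin
  ΣRange 1 (suc m) F             ≡⟨ ΣRange≡sum< 1 (suc m) F ⟩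
  sum< (suc m) (F ∘ suc)         ≡⟨ sum<-cong (suc m) term ⟩
  sum< (suc m) (binomial g f m)  ≡⟨ ⊛-binomial g f m ⟨
  (g ⊛ f) m                      ∎
  where
  open ≡-Reasoning
  F : ℕ → ℚ
  F r = ℕ→ℚ (m C (r ∸ 1)) * f (suc (suc m) ∸ r ∸ 1) * g (r ∸ 1)
  term : ∀ j → j ℕ.< suc m → F (suc j) ≡ binomial g f m j
  term j (s≤s j≤m) = begin
    ℕ→ℚ (m C j) * f (suc m ∸ j ∸ 1) * g j  ≡⟨ cong (λ i → ℕ→ℚ (m C j) * f (i ∸ 1) * g j) (ℕ.+-∸-assoc 1 j≤m) ⟩
    ℕ→ℚ (m C j) * f (m ∸ j) * g j          ≡⟨ *-assoc (ℕ→ℚ (m C j)) (f (m ∸ j)) (g j) ⟩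
    ℕ→ℚ (m C j) * (f (m ∸ j) * g j)        ≡⟨ cong (ℕ→ℚ (m C j) *_) (*-comm (f (m ∸ j)) (g j)) ⟩
    ℕ→ℚ (m C j) * (g j * f (m ∸ j))        ∎

ℚ-almostCommutativeRing : Reflective.AlmostCommutativeRing _ _
ℚ-almostCommutativeRing = Reflective.fromCommutativeRing +-*-commutativeRing (λ p → dec⇒maybe (0ℚ ≟ p))

divide-out : ∀ {b v κ p ι π ρ} → ι * κ ≡ 1ℚ → π * p ≡ 1ℚ → ρ * (p * p) ≡ 1ℚ →
  κ * v ≡ p * p * b - p * b → b * ι * (1ℚ - π) ≡ ρ * v
divide-out {b} {v} {κ} {p} {ι} {π} {ρ} ικ≡1 πp≡1 ρp²≡1 κv≡ = sym (begin
  ρ * v                          ≡⟨ *-identityʳ (ρ * v) ⟨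
  ρ * v * 1ℚ                     ≡⟨ cong (ρ * v *_) ικ≡1 ⟨
  ρ * v * (ι * κ)                ≡⟨ rearrange₁ ρ v ι κ ⟩
  ι * ρ * (κ * v)                ≡⟨ cong (ι * ρ *_) κv≡ ⟩
  ι * ρ * (p * p * b - p * b)    ≡⟨ rearrange₂ ι ρ p b ⟩
  b * ι * (ρ * (p * p) - ρ * p)  ≡⟨ cong₂ (λ x y → b * ι * (x - y)) ρp²≡1 ρp≡π ⟩
  b * ι * (1ℚ - π)               ∎)
  where
  open ≡-Reasoning
  rearrange₁ : ∀ ρ v ι κ → ρ * v * (ι * κ) ≡ ι * ρ * (κ * v)
  rearrange₁ = solve-∀ ℚ-almostCommutativeRing
  rearrange₂ : ∀ ι ρ p b → ι * ρ * (p * p * b - p * b) ≡ b * ι * (ρ * (p * p) - ρ * p)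
  rearrange₂ = solve-∀ ℚ-almostCommutativeRing
  rearrange₃ : ∀ ρ p π → ρ * p * (π * p) ≡ π * (ρ * (p * p))
  rearrange₃ = solve-∀ ℚ-almostCommutativeRing
  ρp≡π : ρ * p ≡ π
  ρp≡π = begin
    ρ * p              ≡⟨ *-identityʳ (ρ * p) ⟨
    ρ * p * 1ℚ         ≡⟨ cong (ρ * p *_) πp≡1 ⟨
    ρ * p * (π * p)    ≡⟨ rearrange₃ ρ p π ⟩
    π * (ρ * (p * p))  ≡⟨ cong (π *_) ρp²≡1 ⟩
    π * 1ℚ             ≡⟨ *-identityʳ π ⟩
    π                  ∎

lemma3p4 : (k : ℕ) → (h : 2 ≤ k) →
    (B k * ((+ 1) / k) {{2≤⇒NonZero h}}) * (1ℚ - ((+ 1) / (2 ^ k)) {{m^n≢0 2 k}})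
      ≡ ((+ 1) / (4 ^ k)) {{m^n≢0 4 k}}
        * ΣRange 1 (k ∸ 1) (λ r → ℕ→ℚ ((k ∸ 2) C (r ∸ 1)) * E (k ∸ r ∸ 1) * E (r ∸ 1))
lemma3p4 k@(suc (suc m)) (s≤s (s≤s z≤n)) = begin
  B k * (+ 1 / k) * (1ℚ - + 1 / 2 ^ k)
    ≡⟨ divide-out {B k} {(E ⊛ E) m} {ℕ→ℚ k} {p} {+ 1 / k} {+ 1 / 2 ^ k} {+ 1 / 4 ^ k}
                  (1/n*n≡1 k) (1/n*n≡1 (2 ^ k)) 1/4ᵏ*p²≡1 coefficient ⟩
  + 1 / 4 ^ k * (E ⊛ E) m
    ≡⟨ cong (+ 1 / 4 ^ k *_) (ΣRange≡⊛ E E m) ⟨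
  + 1 / 4 ^ k * ΣRange 1 (k ∸ 1) (λ r → ℕ→ℚ ((k ∸ 2) C (r ∸ 1)) * E (k ∸ r ∸ 1) * E (r ∸ 1))
    ∎
  where
  open ≡-Reasoning
  instance
    _ = m^n≢0 2 k
    _ = m^n≢0 4 k
  p : ℚ
  p = ℕ→ℚ (2 ^ k)
  pow4≡p² : pow (ℕ→ℚ 4) k ≡ p * p
  pow4≡p² = trans (sym (scale-exp (ℕ→ℚ 2) (ℕ→ℚ 2) k)) (cong₂ _*_ (pow-ℕ→ℚ 2 k) (pow-ℕ→ℚ 2 k))
  1/4ᵏ*p²≡1 : + 1 / 4 ^ k * (p * p) ≡ 1ℚ
  1/4ᵏ*p²≡1 = trans (cong (+ 1 / 4 ^ k *_) (trans (sym pow4≡p²) (pow-ℕ→ℚ 4 k))) (1/n*n≡1 (4 ^ k))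
  coefficient : ℕ→ℚ k * (E ⊛ E) m ≡ p * p * B k - p * B k
  coefficient = trans (sech²-coefficient m) (cong₂ (λ x y → x * B k - y * B k) pow4≡p² (pow-ℕ→ℚ 2 k))
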